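{- Let $n\ge 3$ and $k\ge 1$ be integers and let $G_n=(V_n,E_n)$ be as in the context. Introduce Boolean variables $x_i^{p}$ for $i\in V_n$ and $1\le p\le k$, and consider the weighted clauses \[ \neg x_i^{p} \vee \neg x_j^{p} \ \text{ with weight } 1 \quad ((i,j) \in E_n,\ 1 \le p \le k), \] \[ x_i^{1} \vee \cdots \vee x_i^{k} \ \text{ with weight } k|E_n| \quad (i \in V_n). \] Then $\nu_k(K_n)$ equals the minimum, over all truth assignments, of the total weight of the unsatisfied clauses.
   Context: The $k$-page crossing number $\nu_k(G)$ of a graph $G$ is the minimum number of crossings in a $k$-page drawing of $G$, i.e. a drawing with vertices on a line (spine) and each edge drawn in one of $k$ half-planes bounded by the spine; equivalently, a collection of $k$ circular drawings (vertices on a circle in a common order, edges as chords) of graphs whose edge sets partition $E(G)$. The graph $G_n=(V_n,E_n)$: take a cycle $C_n$ on vertices $v_1,\dots,v_n$; $V_n$ is the set of chords of $C_n$ (vertex pairs at cyclic distance at least $2$), and two chords $v_iv_j$, $v_kv_\ell$ are adjacent if they overlap, i.e. $i,k,j,\ell$ occur in this cyclic order along $C_n$ (in either direction). -}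

module Defs where

open import Data.Nat using (ℕ; zero; suc; _+_; _*_; _<_; _≤_; _<ᵇ_; _≡ᵇ_; _⊓_; _⊔_)
open import Data.Bool using (Bool; true; false; _∧_; _∨_; not; if_then_else_)
open import Data.Fin using (Fin; toℕ)
open import Data.List using (List; map; allFin)
open import Data.Nat.ListAction using (sum)
open import Data.Product using (Σ; _×_; _,_; ∃)
open import Relation.Binary.PropositionalEquality using (_≡_)
open import Function.Definitions using (Injective)

[_] : Bool → ℕ
[ true ] = 1
[ false ] = 0

ΣF : (n : ℕ) → (Fin n → ℕ) → ℕ
ΣF n f = sum (map f (allFin n))

_<F_ : ∀ {n} → Fin n → Fin n → Bool
i <F j = toℕ i <ᵇ toℕ j

_≡F_ : ∀ {m n} → Fin m → Fin n → Bool
i ≡F j = toℕ i ≡ᵇ toℕ j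

-- A k-page drawing: the vertices are placed on the spine at pairwise
-- distinct positions (an injective map pos : Fin n → ℕ, i.e. a linear
-- order of the vertices), and each edge {u,v} (u < v as indices) is
-- assigned a page  page u v : Fin k  (values of page u v for u ≥ v are
-- irrelevant).

record KPageDrawing (k n : ℕ) : Set where
  field
    pos     : Fin n → ℕ
    pos-inj : Injective _≡_ _≡_ pos
    page    : Fin n → Fin n → Fin k

module _ {k n : ℕ} (D : KPageDrawing k n) where
  open KPageDrawing D

  lo hi : Fin n → Fin n → ℕ
  lo u v = pos u ⊓ pos v
  hi u v = pos u ⊔ pos v

  -- the (unordered) pair of edges {u,v}, {w,z} (u<v, w<z as indices)
  -- is counted once, with the edge whose left end is further left first
  crossesB : Fin n → Fin n → Fin n → Fin n → Bool
  crossesB u v w z =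
    (u <F v) ∧ (w <F z) ∧ (page u v ≡F page w z)
    ∧ (lo u v <ᵇ lo w z) ∧ (lo w z <ᵇ hi u v) ∧ (hi u v <ᵇ hi w z)

  crossings : ℕ
  crossings = ΣF n λ u → ΣF n λ v → ΣF n λ w → ΣF n λ z → [ crossesB u v w z ]

IsPageCrossingNumberK : (k n m : ℕ) → Set
IsPageCrossingNumberK k n m =
  Σ (KPageDrawing k n) (λ D → crossings D ≡ m)
  × ((D : KPageDrawing k n) → m ≤ crossings D)

-- The graph G_n.  The cycle C_n has vertices Fin n, v_i ~ v_{i+1 mod n}.
-- A chord is represented by (i , j) with i < j, j - i ≥ 2 and
-- (i , j) ≠ (0 , n-1)  (cyclic distance at least 2).

isChord : (n : ℕ) → Fin n → Fin n → Bool
isChord n i j = (suc (toℕ i) <ᵇ toℕ j) ∧ not ((toℕ i ≡ᵇ 0) ∧ (suc (toℕ j) ≡ᵇ n))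

-- chords (i,j) and (l,m) overlap (i,l,j,m in cyclic order); each
-- unordered pair of overlapping chords is counted once via i < l < j < m
overlapB : (n : ℕ) → Fin n → Fin n → Fin n → Fin n → Bool
overlapB n i j l m =
  isChord n i j ∧ isChord n l m ∧ (i <F l) ∧ (l <F j) ∧ (j <F m)

edgeCount : ℕ → ℕ
edgeCount n = ΣF n λ i → ΣF n λ j → ΣF n λ l → ΣF n λ m → [ overlapB n i j l m ]

-- truth assignment: x (i , j) p  is the variable x_{ij}^{p}
-- (values at non-chords (i,j) are irrelevant)
Assignment : ℕ → ℕ → Set
Assignment k n = Fin n → Fin n → Fin k → Bool

unsatWeight : (k n : ℕ) → Assignment k n → ℕ
unsatWeight k n x =
  (ΣF n λ i → ΣF n λ j → ΣF n λ l → ΣF n λ m → ΣF k λ p →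
     [ overlapB n i j l m ∧ x i j p ∧ x l m p ])
  + (ΣF n λ i → ΣF n λ j →
     [ isChord n i j ∧ allFalse (x i j) ] * (k * edgeCount n))
  where
  allFalse : (Fin k → Bool) → Bool
  allFalse f = not (Data.List.foldr _∨_ false (map f (allFin k)))

IsMinUnsatWeight : (k n m : ℕ) → Set
IsMinUnsatWeight k n m =
  Σ (Assignment k n) (λ x → unsatWeight k n x ≡ m)
  × ((x : Assignment k n) → m ≤ unsatWeight k n x)

module Submission where

-- Both sides equal the least number of crossings of a k-page drawing whose spine
-- order is the cyclic order of C_n.  Counting crossings along the spine, as
-- quadruples a < c < b < d of spine positions with ab and cd on a common page,
-- makes the count invariant under relabelling the vertices by their spine rank;
-- after that relabelling the pairs of crossing edges of a drawing are exactly
-- the overlapping chords of G_n on a common page.  So the assignment "chord ij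
-- lies on page p" has weight at most the crossings of any drawing.  Conversely,
-- an assignment putting every chord on some true page gives a drawing, in cyclic
-- order, with at most its weight in crossings; an assignment leaving a chord
-- uncovered already pays k|E_n|, while a drawing in cyclic order has at most
-- |E_n| crossings.  So the minimum over the finitely many assignments is ν_k(K_n).

open import Defs
open import Data.Nat using (ℕ; zero; suc; _+_; _*_; _≤_; _<_; _<ᵇ_; _≡ᵇ_; _⊓_; _⊔_; z≤n; s≤s)
open import Data.Nat.Properties
import Data.Nat.ListAction as List
open import Data.Bool using (Bool; true; false; _∧_; not; T; if_then_else_)
open import Data.Bool.Properties using (T?; T-∧)
open import Data.Bool.ListAction using (any; or)
open import Data.Fin using (Fin; zero; suc; toℕ; fromℕ<; punchOut)
open import Data.Fin.Properties
  using (toℕ-injective; toℕ<n; toℕ-fromℕ<; any?; injective⇒≤; punchOut-injective) renaming (_≟_ to _≟ᶠ_)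
open import Data.Fin.Permutation as Perm using (Permutation; _⟨$⟩ʳ_; _⟨$⟩ˡ_)
open import Data.List using ([]; _∷_; map; allFin; tabulate)
open import Data.List.Properties using (map-cong; map-tabulate)
open import Data.List.Membership.Propositional using (_∈_; lose)
open import Data.List.Membership.Propositional.Properties using (∈-allFin)
open import Data.List.Relation.Unary.Any using (here; there; satisfied)
open import Data.List.Relation.Unary.Any.Properties using (any⁺; any⁻)
open import Data.Vec.Functional using (Vector; head; tail) renaming (_∷_ to _◂_)
import Data.Vec.Functional.Relation.Binary.Equality.Setoid as VectorEquality
open import Data.Product using (Σ; _×_; _,_; proj₁; proj₂; ∃)
open import Data.Sum using (_⊎_; inj₁; inj₂; [_,_]′)
open import Data.Unit using (tt)
open import Data.Empty using (⊥-elim)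
open import Function using (_∘_; id)
open import Function.Bundles using (Equivalence)
open import Function.Definitions using (Congruent; Injective)
open import Relation.Binary.Bundles using (Setoid)
open import Relation.Binary.Definitions using (tri<; tri≈; tri>)
open import Relation.Binary.PropositionalEquality hiding ([_])
open import Relation.Nullary using (¬_; yes; no)
import Algebra.Properties.Semiring.Sum as SemiringSum

module ∑ = SemiringSum +-*-semiring

module _ {A : Set} {f g : A → ℕ} where

  sum-map-mono-≤ : (∀ x → f x ≤ g x) → ∀ xs → List.sum (map f xs) ≤ List.sum (map g xs)
  sum-map-mono-≤ f≤g [] = z≤n
  sum-map-mono-≤ f≤g (x ∷ xs) = +-mono-≤ (f≤g x) (sum-map-mono-≤ f≤g xs)

  sum-map-mono-< : (∀ x → f x ≤ g x) → ∀ {x xs} → x ∈ xs → f x < g x →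
                   List.sum (map f xs) < List.sum (map g xs)
  sum-map-mono-< f≤g {xs = _ ∷ xs} (here refl) fx<gx = +-mono-<-≤ fx<gx (sum-map-mono-≤ f≤g xs)
  sum-map-mono-< f≤g {xs = y ∷ _} (there x∈xs) fx<gx = +-mono-≤-< (f≤g y) (sum-map-mono-< f≤g x∈xs fx<gx)

∈⇒≤-sum-map : ∀ {A : Set} (f : A → ℕ) {x xs} → x ∈ xs → f x ≤ List.sum (map f xs)
∈⇒≤-sum-map f (here refl) = m≤m+n _ _
∈⇒≤-sum-map f {xs = y ∷ _} (there x∈xs) = ≤-trans (∈⇒≤-sum-map f x∈xs) (m≤n+m _ (f y))

ΣF≡∑ : ∀ n (f : Fin n → ℕ) → ΣF n f ≡ ∑.sum f
ΣF≡∑ n f = trans (cong List.sum (map-tabulate id f)) (sum-tabulate n f)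
  where
  sum-tabulate : ∀ n (g : Fin n → ℕ) → List.sum (tabulate g) ≡ ∑.sum g
  sum-tabulate zero g = refl
  sum-tabulate (suc n) g = cong (g zero +_) (sum-tabulate n (g ∘ suc))

ΣF-cong : ∀ n {f g : Fin n → ℕ} → (∀ i → f i ≡ g i) → ΣF n f ≡ ΣF n g
ΣF-cong n f≗g = cong List.sum (map-cong f≗g (allFin n))

ΣF-mono-≤ : ∀ n {f g : Fin n → ℕ} → (∀ i → f i ≤ g i) → ΣF n f ≤ ΣF n g
ΣF-mono-≤ n f≤g = sum-map-mono-≤ f≤g (allFin n)

ΣF-mono-< : ∀ n {f g : Fin n → ℕ} → (∀ i → f i ≤ g i) → ∀ i → f i < g i → ΣF n f < ΣF n g
ΣF-mono-< n f≤g i = sum-map-mono-< f≤g (∈-allFin i)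

≤-ΣF : ∀ n (f : Fin n → ℕ) i → f i ≤ ΣF n f
≤-ΣF n f i = ∈⇒≤-sum-map f (∈-allFin i)

ΣF-const : ∀ n c → ΣF n (λ _ → c) ≡ n * c
ΣF-const n c = trans (ΣF≡∑ n _) (∑-const n)
  where
  ∑-const : ∀ n → ∑.sum {n} (λ _ → c) ≡ n * c
  ∑-const zero = refl
  ∑-const (suc n) = cong (c +_) (∑-const n)

ΣF-zero : ∀ n {f : Fin n → ℕ} → (∀ i → f i ≡ 0) → ΣF n f ≡ 0
ΣF-zero n f≗0 = trans (ΣF-cong n f≗0) (trans (ΣF-const n 0) (*-zeroʳ n))

ΣF-comm : ∀ m n (f : Fin m → Fin n → ℕ) →
          ΣF m (λ i → ΣF n (f i)) ≡ ΣF n (λ j → ΣF m (λ i → f i j))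
ΣF-comm m n f = begin
  ΣF m (λ i → ΣF n (f i))              ≡⟨ ΣF-cong m (λ i → ΣF≡∑ n (f i)) ⟩
  ΣF m (λ i → ∑.sum (f i))             ≡⟨ ΣF≡∑ m _ ⟩
  ∑.sum (λ i → ∑.sum (f i))            ≡⟨ ∑.∑-comm f ⟩
  ∑.sum (λ j → ∑.sum (λ i → f i j))    ≡⟨ sym (ΣF≡∑ n _) ⟩
  ΣF n (λ j → ∑.sum (λ i → f i j))     ≡⟨ sym (ΣF-cong n (λ j → ΣF≡∑ m (λ i → f i j))) ⟩
  ΣF n (λ j → ΣF m (λ i → f i j))      ∎
  where open ≡-Reasoning

ΣF-distrib-+ : ∀ n (f g : Fin n → ℕ) → ΣF n (λ i → f i + g i) ≡ ΣF n f + ΣF n g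
ΣF-distrib-+ n f g = begin
  ΣF n (λ i → f i + g i)   ≡⟨ ΣF≡∑ n _ ⟩
  ∑.sum (λ i → f i + g i)  ≡⟨ ∑.∑-distrib-+ f g ⟩
  ∑.sum f + ∑.sum g        ≡⟨ sym (cong₂ _+_ (ΣF≡∑ n f) (ΣF≡∑ n g)) ⟩
  ΣF n f + ΣF n g          ∎
  where open ≡-Reasoning

ΣF-*ˡ : ∀ n c (f : Fin n → ℕ) → ΣF n (λ i → c * f i) ≡ c * ΣF n f
ΣF-*ˡ n c f = begin
  ΣF n (λ i → c * f i)   ≡⟨ ΣF≡∑ n _ ⟩
  ∑.sum (λ i → c * f i)  ≡⟨ sym (∑.*-distribˡ-sum c f) ⟩
  c * ∑.sum f            ≡⟨ sym (cong (c *_) (ΣF≡∑ n f)) ⟩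
  c * ΣF n f             ∎
  where open ≡-Reasoning

ΣF-permute : ∀ n (f : Fin n → ℕ) (π : Permutation n n) → ΣF n f ≡ ΣF n (f ∘ (π ⟨$⟩ʳ_))
ΣF-permute n f π = trans (ΣF≡∑ n f) (trans (∑.∑-permute f π) (sym (ΣF≡∑ n _)))

ΣF² : ∀ n → (Fin n → Fin n → ℕ) → ℕ
ΣF² n F = ΣF n (λ u → ΣF n (F u))

ΣF²-cong : ∀ n {F G : Fin n → Fin n → ℕ} → (∀ u v → F u v ≡ G u v) → ΣF² n F ≡ ΣF² n G
ΣF²-cong n F≗G = ΣF-cong n (λ u → ΣF-cong n (F≗G u))

ΣF²-mono-≤ : ∀ n {F G : Fin n → Fin n → ℕ} → (∀ u v → F u v ≤ G u v) → ΣF² n F ≤ ΣF² n G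
ΣF²-mono-≤ n F≤G = ΣF-mono-≤ n (λ u → ΣF-mono-≤ n (F≤G u))

≤-ΣF² : ∀ n (F : Fin n → Fin n → ℕ) u v → F u v ≤ ΣF² n F
≤-ΣF² n F u v = ≤-trans (≤-ΣF n (F u) v) (≤-ΣF n _ u)

ΣF²-*ˡ : ∀ n c (F : Fin n → Fin n → ℕ) → ΣF² n (λ u v → c * F u v) ≡ c * ΣF² n F
ΣF²-*ˡ n c F = trans (ΣF-cong n (λ u → ΣF-*ˡ n c (F u))) (ΣF-*ˡ n c _)

ΣF²-*ʳ : ∀ n c (F : Fin n → Fin n → ℕ) → ΣF² n (λ u v → F u v * c) ≡ ΣF² n F * c
ΣF²-*ʳ n c F = trans (ΣF²-cong n (λ u v → *-comm (F u v) c)) (trans (ΣF²-*ˡ n c F) (*-comm c _))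

ΣF²-zero : ∀ n {F : Fin n → Fin n → ℕ} → (∀ u v → F u v ≡ 0) → ΣF² n F ≡ 0
ΣF²-zero n F≗0 = ΣF-zero n (λ u → ΣF-zero n (F≗0 u))

ΣF⁴-mono-≤ : ∀ n {F G : Fin n → Fin n → Fin n → Fin n → ℕ} → (∀ i j l m → F i j l m ≤ G i j l m) →
             ΣF² n (λ i j → ΣF² n (F i j)) ≤ ΣF² n (λ i j → ΣF² n (G i j))
ΣF⁴-mono-≤ n F≤G = ΣF²-mono-≤ n (λ i j → ΣF²-mono-≤ n (F≤G i j))

ΣF²-distrib-+ : ∀ n (F G : Fin n → Fin n → ℕ) → ΣF² n (λ u v → F u v + G u v) ≡ ΣF² n F + ΣF² n G
ΣF²-distrib-+ n F G = trans (ΣF-cong n (λ u → ΣF-distrib-+ n (F u) (G u))) (ΣF-distrib-+ n _ _)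

[]≤1 : ∀ b → [ b ] ≤ 1
[]≤1 false = z≤n
[]≤1 true = s≤s z≤n

[]≤ : ∀ {b m} → (T b → 1 ≤ m) → [ b ] ≤ m
[]≤ {false} _ = z≤n
[]≤ {true} 1≤m = 1≤m tt

[]-true : ∀ {b} → T b → [ b ] ≡ 1
[]-true {true} _ = refl

[]-mono : ∀ {a b} → (T a → T b) → [ a ] ≤ [ b ]
[]-mono a⇒b = []≤ (λ ta → ≤-reflexive (sym ([]-true (a⇒b ta))))

[]-false : ∀ {b} → ¬ T b → [ b ] ≡ 0
[]-false {false} _ = refl
[]-false {true} ¬tt = ⊥-elim (¬tt tt)

infixr 6 _∧ᵀ_
_∧ᵀ_ : ∀ {a b} → T a → T b → T (a ∧ b)
ta ∧ᵀ tb = Equivalence.from T-∧ (ta , tb)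

split-∧ᵀ : ∀ a {b} → T (a ∧ b) → T a × T b
split-∧ᵀ _ = Equivalence.to T-∧

≡F⇒≡ : ∀ {n} (a b : Fin n) → T (a ≡F b) → a ≡ b
≡F⇒≡ a b = toℕ-injective ∘ ≡ᵇ⇒≡ (toℕ a) (toℕ b)

≡⇒≡F : ∀ {n} {a b : Fin n} → a ≡ b → T (a ≡F b)
≡⇒≡F = ≡⇒≡ᵇ _ _ ∘ cong toℕ

T-not⇒¬T : ∀ {b} → T (not b) → ¬ T b
T-not⇒¬T {false} _ ()

¬T⇒T-not : ∀ {b} → ¬ T b → T (not b)
¬T⇒T-not {false} _ = tt
¬T⇒T-not {true} ¬tt = ¬tt tt

[]-absorbˡ : ∀ {a c} → (T c → T a) → [ a ∧ c ] ≡ [ c ]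
[]-absorbˡ {true} _ = refl
[]-absorbˡ {false} c⇒a = sym ([]-false c⇒a)

[]-guarded : ∀ a b {c c'} → (T a → T b → c ≡ c') → [ a ∧ b ∧ c ] ≡ [ a ] * ([ b ] * [ c' ])
[]-guarded false b _ = refl
[]-guarded true false _ = refl
[]-guarded true true c≡c' = trans (cong [_] (c≡c' tt tt)) (sym (trans (+-identityʳ _) (+-identityʳ _)))

-- Both sides are half of the sum of (γ u v + γ v u) * G u v, for γ = α, β.
ΣF²-orientation : ∀ n (α β G : Fin n → Fin n → ℕ) →
                  (∀ u v → α u v + α v u ≡ β u v + β v u) → (∀ u v → G u v ≡ G v u) →
                  ΣF² n (λ u v → α u v * G u v) ≡ ΣF² n (λ u v → β u v * G u v)
ΣF²-orientation n α β G α~β G-sym = *-cancelˡ-≡ _ _ 2 (begin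
  2 * ΣF² n (λ u v → α u v * G u v)                ≡⟨ doubled α ⟩
  ΣF² n (λ u v → (α u v + α v u) * G u v)          ≡⟨ ΣF²-cong n (λ u v → cong (_* G u v) (α~β u v)) ⟩
  ΣF² n (λ u v → (β u v + β v u) * G u v)          ≡⟨ doubled β ⟨
  2 * ΣF² n (λ u v → β u v * G u v)                ∎)
  where
  open ≡-Reasoning
  doubled : ∀ γ → 2 * ΣF² n (λ u v → γ u v * G u v) ≡ ΣF² n (λ u v → (γ u v + γ v u) * G u v)
  doubled γ = begin
    2 * S                                             ≡⟨ cong (S +_) (+-identityʳ S) ⟩
    S + S                                             ≡⟨ cong (S +_) (ΣF-comm n n _) ⟩
    S + ΣF² n (λ v u → γ u v * G u v)                 ≡⟨ cong (S +_) (ΣF²-cong n (λ v u → cong (γ u v *_) (G-sym u v))) ⟩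
    S + ΣF² n (λ u v → γ v u * G u v)                 ≡⟨ ΣF²-distrib-+ n _ _ ⟨
    ΣF² n (λ u v → γ u v * G u v + γ v u * G u v)     ≡⟨ ΣF²-cong n (λ u v → *-distribʳ-+ (G u v) (γ u v) (γ v u)) ⟨
    ΣF² n (λ u v → (γ u v + γ v u) * G u v)           ∎
    where
    S : ℕ
    S = ΣF² n (λ u v → γ u v * G u v)

[<ᵇ]-irrefl : ∀ m → [ m <ᵇ m ] ≡ 0
[<ᵇ]-irrefl m = []-false (λ t → <-irrefl refl (<ᵇ⇒< m m t))

[<ᵇ]-≢ : ∀ {m n} → m ≢ n → [ m <ᵇ n ] + [ n <ᵇ m ] ≡ 1
[<ᵇ]-≢ {m} {n} m≢n with <-cmp m n
... | tri< m<n _ n≮m = cong₂ _+_ ([]-true (<⇒<ᵇ m<n)) ([]-false (n≮m ∘ <ᵇ⇒< n m))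
... | tri≈ _ m≡n _ = ⊥-elim (m≢n m≡n)
... | tri> m≮n _ n<m = cong₂ _+_ ([]-false (m≮n ∘ <ᵇ⇒< m n)) ([]-true (<⇒<ᵇ n<m))

<ᵇ-orientation : ∀ {A : Set} (f g : A → ℕ) → Injective _≡_ _≡_ f → Injective _≡_ _≡_ g →
                 ∀ u v → [ f u <ᵇ f v ] + [ f v <ᵇ f u ] ≡ [ g u <ᵇ g v ] + [ g v <ᵇ g u ]
<ᵇ-orientation f g f-inj g-inj u v with f u ≟ f v
... | yes fu≡fv rewrite f-inj fu≡fv = trans (irrefl-pair (f v)) (sym (irrefl-pair (g v)))
  where
  irrefl-pair : ∀ m → [ m <ᵇ m ] + [ m <ᵇ m ] ≡ 0
  irrefl-pair m = cong₂ _+_ ([<ᵇ]-irrefl m) ([<ᵇ]-irrefl m)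
... | no fu≢fv = trans ([<ᵇ]-≢ fu≢fv) (sym ([<ᵇ]-≢ (fu≢fv ∘ cong f ∘ g-inj)))

HasMinima : ∀ {a ℓ} → Setoid a ℓ → Set _
HasMinima S = ∀ (W : Carrier → ℕ) → Congruent _≈_ _≡_ W → ∃ λ x → ∀ y → W x ≤ W y
  where open Setoid S

bool-hasMinima : HasMinima (setoid Bool)
bool-hasMinima W _ with ≤-total (W true) (W false)
... | inj₁ t≤f = true , λ { true → ≤-refl ; false → t≤f }
... | inj₂ f≤t = false , λ { true → f≤t ; false → ≤-refl }

module _ {a ℓ} (S : Setoid a ℓ) where
  open Setoid S using (Carrier; _≈_) renaming (refl to ≈-refl; sym to ≈-sym)
  open VectorEquality S using (≋-setoid)

  vector-hasMinima : HasMinima S → ∀ m → HasMinima (≋-setoid m)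
  vector-hasMinima min-S zero W W-cong = (λ ()) , λ y → ≤-reflexive (W-cong (λ ()))
  vector-hasMinima min-S (suc m) W W-cong = x₀ ◂ best x₀ , minimal
    where
    cons-cong : ∀ {a a' t t'} → a ≈ a' → (∀ i → t i ≈ t' i) → ∀ i → (a ◂ t) i ≈ (a' ◂ t') i
    cons-cong a≈a' t≋t' zero = a≈a'
    cons-cong a≈a' t≋t' (suc i) = t≋t' i

    minimalTail : ∀ a → ∃ λ t → ∀ t' → W (a ◂ t) ≤ W (a ◂ t')
    minimalTail a = vector-hasMinima min-S m (W ∘ (a ◂_)) (λ t≋t' → W-cong (cons-cong ≈-refl t≋t'))

    best : Carrier → Vector Carrier m
    best a = proj₁ (minimalTail a)

    V : Carrier → ℕ
    V a = W (a ◂ best a)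

    V-cong : Congruent _≈_ _≡_ V
    V-cong {a} {a'} a≈a' = ≤-antisym (switch a≈a') (switch (≈-sym a≈a'))
      where
      switch : ∀ {a a'} → a ≈ a' → V a ≤ V a'
      switch {a} {a'} a≈a' = ≤-trans (proj₂ (minimalTail a) (best a')) (≤-reflexive (W-cong (cons-cong a≈a' (λ _ → ≈-refl))))

    x₀ : Carrier
    x₀ = proj₁ (min-S V V-cong)

    minimal : ∀ y → V x₀ ≤ W y
    minimal y = ≤-trans (proj₂ (min-S V V-cong) (head y)) (≤-trans (proj₂ (minimalTail (head y)) (tail y))
                  (≤-reflexive (W-cong λ { zero → ≈-refl ; (suc i) → ≈-refl })))

AssignmentSetoid : ℕ → ℕ → Setoid _ _
AssignmentSetoid k n = ≋-setoid (≋-setoid (≋-setoid (setoid Bool) k) n) n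
  where open VectorEquality using (≋-setoid)

assignment-hasMinima : ∀ k n → HasMinima (AssignmentSetoid k n)
assignment-hasMinima k n = vector-hasMinima rows (vector-hasMinima pages (vector-hasMinima (setoid Bool) bool-hasMinima k) n) n
  where
  open VectorEquality using (≋-setoid)
  pages rows : Setoid _ _
  pages = ≋-setoid (setoid Bool) k
  rows = ≋-setoid pages n

conflicts : ∀ k n → Assignment k n → ℕ
conflicts k n x = ΣF² n λ i j → ΣF² n λ l m → ΣF k λ p → [ overlapB n i j l m ∧ x i j p ∧ x l m p ]

uncovered : ∀ k n → Assignment k n → ℕ
uncovered k n x = ΣF² n λ i j → [ isChord n i j ∧ not (any (x i j) (allFin k)) ]

unsatWeight-split : ∀ k n x → unsatWeight k n x ≡ conflicts k n x + uncovered k n x * (k * edgeCount n)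
unsatWeight-split k n x = cong (conflicts k n x +_) (ΣF²-*ʳ n (k * edgeCount n) _)

overlapB-ordered : ∀ {n} (i j l m : Fin n) → T (overlapB n i j l m) →
                   toℕ i < toℕ l × toℕ l < toℕ j × toℕ j < toℕ m
overlapB-ordered {n} i j l m t =
  let _ , t₁ = split-∧ᵀ (isChord n i j) t
      _ , t₂ = split-∧ᵀ (isChord n l m) t₁
      i<l , t₃ = split-∧ᵀ (i <F l) t₂
      l<j , j<m = split-∧ᵀ (l <F j) t₃
  in <ᵇ⇒< _ _ i<l , <ᵇ⇒< _ _ l<j , <ᵇ⇒< _ _ j<m

isChord-intro : ∀ {n} (a b : Fin n) → suc (toℕ a) < toℕ b → toℕ a ≢ 0 ⊎ suc (toℕ b) ≢ n → T (isChord n a b)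
isChord-intro {n} a b gap not-wrapped = <⇒<ᵇ gap ∧ᵀ ¬T⇒T-not λ t →
  let a≡0 , b≡n-1 = split-∧ᵀ (toℕ a ≡ᵇ 0) t
  in [ (λ a≢0 → a≢0 (≡ᵇ⇒≡ _ _ a≡0)) , (λ b≢n-1 → b≢n-1 (≡ᵇ⇒≡ _ _ b≡n-1)) ]′ not-wrapped

ordered⇒overlapB : ∀ {n} (i j l m : Fin n) → toℕ i < toℕ l → toℕ l < toℕ j → toℕ j < toℕ m → T (overlapB n i j l m)
ordered⇒overlapB i j l m i<l l<j j<m =
  isChord-intro i j (≤-trans (s≤s i<l) l<j) (inj₂ (<⇒≢ (≤-trans (s≤s j<m) (toℕ<n m))))
  ∧ᵀ isChord-intro l m (≤-trans (s≤s l<j) j<m) (inj₁ (n>0⇒n≢0 (≤-<-trans z≤n i<l)))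
  ∧ᵀ <⇒<ᵇ i<l ∧ᵀ <⇒<ᵇ l<j ∧ᵀ <⇒<ᵇ j<m

unsatWeight-cong : ∀ k n → Congruent (Setoid._≈_ (AssignmentSetoid k n)) _≡_ (unsatWeight k n)
unsatWeight-cong k n x≈y = cong₂ _+_
  (ΣF²-cong n λ i j → ΣF²-cong n λ l m → ΣF-cong k λ p →
     cong₂ (λ a b → [ overlapB n i j l m ∧ a ∧ b ]) (x≈y i j p) (x≈y l m p))
  (ΣF²-cong n λ i j → cong (λ bs → [ isChord n i j ∧ not (or bs) ] * (k * edgeCount n)) (map-cong (x≈y i j) (allFin k)))

ΣF-[≡F] : ∀ k (a : Fin k) → ΣF k (λ p → [ a ≡F p ]) ≡ 1
ΣF-[≡F] k a = trans (ΣF≡∑ k (λ p → [ a ≡F p ])) (∑-[≡F] a)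
  where
  ∑-[≡F] : ∀ {k} (a : Fin k) → ∑.sum {k} (λ p → [ a ≡F p ]) ≡ 1
  ∑-[≡F] {suc k} zero = cong suc (∑.sum-replicate-zero k)
  ∑-[≡F] (suc a) = ∑-[≡F] a

ΣF-shared-page : ∀ k c (a b : Fin k) → ΣF k (λ p → [ c ∧ (a ≡F p) ∧ (b ≡F p) ]) ≤ [ c ∧ (a ≡F b) ]
ΣF-shared-page k c a b = begin
  ΣF k (λ p → [ c ∧ (a ≡F p) ∧ (b ≡F p) ])  ≤⟨ ΣF-mono-≤ k bound ⟩
  ΣF k (λ p → [ c ∧ (a ≡F b) ] * [ a ≡F p ])  ≡⟨ ΣF-*ˡ k [ c ∧ (a ≡F b) ] (λ p → [ a ≡F p ]) ⟩
  [ c ∧ (a ≡F b) ] * ΣF k (λ p → [ a ≡F p ])  ≡⟨ cong ([ c ∧ (a ≡F b) ] *_) (ΣF-[≡F] k a) ⟩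
  [ c ∧ (a ≡F b) ] * 1                          ≡⟨ *-identityʳ _ ⟩
  [ c ∧ (a ≡F b) ]                              ∎
  where
  open ≤-Reasoning
  bound : ∀ p → [ c ∧ (a ≡F p) ∧ (b ≡F p) ] ≤ [ c ∧ (a ≡F b) ] * [ a ≡F p ]
  bound p = []≤ λ t →
    let tc , t′ = split-∧ᵀ c t
        a≡p , b≡p = split-∧ᵀ (a ≡F p) t′
    in ≤-reflexive (sym (cong₂ _*_ ([]-true (tc ∧ᵀ ≡⇒≡F (trans (≡F⇒≡ a p a≡p) (sym (≡F⇒≡ b p b≡p))))) ([]-true a≡p)))

-- Crossings counted along the spine

interleaving-ordered : ∀ {p q r s} → p < q → r < s →
                ((p ⊓ q <ᵇ r ⊓ s) ∧ (r ⊓ s <ᵇ p ⊔ q) ∧ (p ⊔ q <ᵇ r ⊔ s)) ≡ ((p <ᵇ r) ∧ (r <ᵇ q) ∧ (q <ᵇ s))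
interleaving-ordered p<q r<s
  rewrite m≤n⇒m⊓n≡m (<⇒≤ p<q) | m≤n⇒m⊔n≡n (<⇒≤ p<q) | m≤n⇒m⊓n≡m (<⇒≤ r<s) | m≤n⇒m⊔n≡n (<⇒≤ r<s) = refl

module Spine {k n} (D : KPageDrawing k n) where
  open KPageDrawing D

  edgePage : Fin n → Fin n → Fin k
  edgePage u v = if u <F v then page u v else page v u

  edgePage-< : ∀ {u v} → T (u <F v) → edgePage u v ≡ page u v
  edgePage-< {u} {v} _ with u <F v
  ... | true = refl

  edgePage-≮ : ∀ {u v} → ¬ T (u <F v) → edgePage u v ≡ page v u
  edgePage-≮ {u} {v} u≮v with u <F v
  ... | true = ⊥-elim (u≮v tt)
  ... | false = refl

  edgePage-comm : ∀ u v → edgePage u v ≡ edgePage v u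
  edgePage-comm u v with <-cmp (toℕ u) (toℕ v)
  ... | tri< u<v _ v≮u = trans (edgePage-< (<⇒<ᵇ u<v)) (sym (edgePage-≮ (v≮u ∘ <ᵇ⇒< _ _)))
  ... | tri≈ _ u≡v _ rewrite toℕ-injective u≡v = refl
  ... | tri> u≮v _ v<u = trans (edgePage-≮ (u≮v ∘ <ᵇ⇒< _ _)) (sym (edgePage-< (<⇒<ᵇ v<u)))

  infix 4 _<ᵖ_
  _<ᵖ_ : Fin n → Fin n → Bool
  u <ᵖ v = pos u <ᵇ pos v

  crossingChain : Fin n → Fin n → Fin n → Fin n → Bool
  crossingChain a b c d =
    (edgePage a b ≡F edgePage c d) ∧ (a <ᵖ c) ∧ (c <ᵖ b) ∧ (b <ᵖ d)

  crossingChain⇒ : ∀ a b c d → T (crossingChain a b c d) →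
                   T (edgePage a b ≡F edgePage c d) × pos a < pos c × pos c < pos b × pos b < pos d
  crossingChain⇒ a b c d t =
    let same , t₁ = split-∧ᵀ (edgePage a b ≡F edgePage c d) t
        a<c , t₂ = split-∧ᵀ (a <ᵖ c) t₁
        c<b , b<d = split-∧ᵀ (c <ᵖ b) t₂
    in same , <ᵇ⇒< _ _ a<c , <ᵇ⇒< _ _ c<b , <ᵇ⇒< _ _ b<d

  crossingChain-ordered : ∀ a b c d → T (crossingChain a b c d) → pos a < pos b × pos c < pos d
  crossingChain-ordered a b c d t = let _ , a<c , c<b , b<d = crossingChain⇒ a b c d t in <-trans a<c c<b , <-trans c<b b<d

  spineCrossings : ℕ
  spineCrossings = ΣF² n λ a b → ΣF² n λ c d → [ crossingChain a b c d ]

  crossings≡spineCrossings : crossings D ≡ spineCrossings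
  crossings≡spineCrossings = begin
    crossings D
      ≡⟨ ΣF²-cong n (λ u v → ΣF²-cong n (λ w z → by-index u v w z)) ⟩
    ΣF² n (λ u v → ΣF² n (λ w z → [ u <F v ] * ([ w <F z ] * H u v w z)))
      ≡⟨ ΣF²-cong n (λ u v → ΣF²-*ˡ n [ u <F v ] _) ⟩
    ΣF² n (λ u v → [ u <F v ] * ΣF² n (λ w z → [ w <F z ] * H u v w z))
      ≡⟨ ΣF²-cong n (λ u v → cong ([ u <F v ] *_) (reorient (H u v) (H-comm₂ u v))) ⟩
    ΣF² n (λ u v → [ u <F v ] * ΣF² n (λ w z → [ w <ᵖ z ] * H u v w z))
      ≡⟨ reorient _ (λ u v → ΣF²-cong n (λ w z → cong ([ w <ᵖ z ] *_) (H-comm₁ u v w z))) ⟩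
    ΣF² n (λ u v → [ u <ᵖ v ] * ΣF² n (λ w z → [ w <ᵖ z ] * H u v w z))
      ≡⟨ ΣF²-cong n (λ u v → ΣF²-*ˡ n [ u <ᵖ v ] _) ⟨
    ΣF² n (λ u v → ΣF² n (λ w z → [ u <ᵖ v ] * ([ w <ᵖ z ] * H u v w z)))
      ≡⟨ ΣF²-cong n (λ u v → ΣF²-cong n (λ w z → by-position u v w z)) ⟩
    spineCrossings
      ∎
    where
    open ≡-Reasoning

    interleaving : Fin n → Fin n → Fin n → Fin n → Bool
    interleaving a b c d = (lo D a b <ᵇ lo D c d) ∧ (lo D c d <ᵇ hi D a b) ∧ (hi D a b <ᵇ hi D c d)

    H : Fin n → Fin n → Fin n → Fin n → ℕ
    H a b c d = [ (edgePage a b ≡F edgePage c d) ∧ interleaving a b c d ]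

    H-comm₁ : ∀ a b c d → H a b c d ≡ H b a c d
    H-comm₁ a b c d rewrite edgePage-comm a b | ⊓-comm (pos a) (pos b) | ⊔-comm (pos a) (pos b) = refl

    H-comm₂ : ∀ a b c d → H a b c d ≡ H a b d c
    H-comm₂ a b c d rewrite edgePage-comm c d | ⊓-comm (pos c) (pos d) | ⊔-comm (pos c) (pos d) = refl

    reorient : (G : Fin n → Fin n → ℕ) → (∀ u v → G u v ≡ G v u) →
               ΣF² n (λ u v → [ u <F v ] * G u v) ≡ ΣF² n (λ u v → [ u <ᵖ v ] * G u v)
    reorient G G-comm =
      ΣF²-orientation n (λ u v → [ u <F v ]) (λ u v → [ u <ᵖ v ]) G (<ᵇ-orientation toℕ pos toℕ-injective pos-inj) G-comm

    by-index : ∀ u v w z → [ crossesB D u v w z ] ≡ [ u <F v ] * ([ w <F z ] * H u v w z)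
    by-index u v w z = []-guarded (u <F v) (w <F z) λ u<v w<z →
      cong (_∧ interleaving u v w z) (cong₂ _≡F_ (sym (edgePage-< u<v)) (sym (edgePage-< w<z)))

    by-position : ∀ u v w z → [ u <ᵖ v ] * ([ w <ᵖ z ] * H u v w z) ≡ [ crossingChain u v w z ]
    by-position u v w z = begin
      [ u <ᵖ v ] * ([ w <ᵖ z ] * H u v w z)             ≡⟨ []-guarded (u <ᵖ v) (w <ᵖ z) chain≡ ⟨
      [ (u <ᵖ v) ∧ (w <ᵖ z) ∧ crossingChain u v w z ]   ≡⟨ []-absorbˡ u<v ⟩
      [ (w <ᵖ z) ∧ crossingChain u v w z ]              ≡⟨ []-absorbˡ w<z ⟩
      [ crossingChain u v w z ]                         ∎
      where
      chain≡ : T (u <ᵖ v) → T (w <ᵖ z) → crossingChain u v w z ≡ (edgePage u v ≡F edgePage w z) ∧ interleaving u v w z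
      chain≡ u<v w<z = cong ((edgePage u v ≡F edgePage w z) ∧_)
        (sym (interleaving-ordered (<ᵇ⇒< (pos u) (pos v) u<v) (<ᵇ⇒< (pos w) (pos z) w<z)))
      u<v : T ((w <ᵖ z) ∧ crossingChain u v w z) → T (u <ᵖ v)
      u<v t = <⇒<ᵇ (proj₁ (crossingChain-ordered u v w z (proj₂ (split-∧ᵀ (w <ᵖ z) t))))
      w<z : T (crossingChain u v w z) → T (w <ᵖ z)
      w<z t = <⇒<ᵇ (proj₂ (crossingChain-ordered u v w z t))

-- Relabelling the vertices by spine rank

injective⇒surjective : ∀ {n} (f : Fin n → Fin n) → Injective _≡_ _≡_ f → ∀ i → ∃ λ u → f u ≡ i
injective⇒surjective {suc m} f f-inj i with any? (λ u → f u ≟ᶠ i)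
... | yes hit = hit
... | no miss = ⊥-elim (1+n≰n (injective⇒≤ {f = avoid} avoid-injective))
  where
  avoid : Fin (suc m) → Fin m
  avoid u = punchOut {i = i} {j = f u} (λ i≡fu → miss (u , sym i≡fu))
  avoid-injective : Injective _≡_ _≡_ avoid
  avoid-injective {u} {v} = f-inj ∘ punchOut-injective (λ e → miss (u , sym e)) (λ e → miss (v , sym e))

injective⇒permutation : ∀ {n} (f : Fin n → Fin n) → Injective _≡_ _≡_ f → Permutation n n
injective⇒permutation f f-inj = Perm.permutation f section (proj₂ ∘ surjection) (λ u → f-inj (proj₂ (surjection (f u))))
  where
  surjection : ∀ i → ∃ λ u → f u ≡ i
  surjection = injective⇒surjective f f-inj
  section : Fin _ → Fin _
  section = proj₁ ∘ surjection

module Rank {n} (pos : Fin n → ℕ) (pos-inj : Injective _≡_ _≡_ pos) where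

  rankℕ : Fin n → ℕ
  rankℕ u = ΣF n (λ w → [ pos w <ᵇ pos u ])

  rankℕ-< : ∀ {u v} → pos u < pos v → rankℕ u < rankℕ v
  rankℕ-< {u} {v} u<v = ΣF-mono-< n (λ w → []-mono (λ w<u → <⇒<ᵇ (<-trans (<ᵇ⇒< _ _ w<u) u<v))) u
    (subst₂ _<_ (sym ([<ᵇ]-irrefl (pos u))) (sym ([]-true (<⇒<ᵇ u<v))) (s≤s z≤n))

  rankℕ<n : ∀ u → rankℕ u < n
  rankℕ<n u = subst (rankℕ u <_) (trans (ΣF-const n 1) (*-identityʳ n))
    (ΣF-mono-< n (λ w → []≤1 _) u (subst (_< 1) (sym ([<ᵇ]-irrefl (pos u))) (s≤s z≤n)))

  rank : Fin n → Fin n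
  rank u = fromℕ< (rankℕ<n u)

  rank-< : ∀ {u v} → pos u < pos v → toℕ (rank u) < toℕ (rank v)
  rank-< u<v = subst₂ _<_ (sym (toℕ-fromℕ< _)) (sym (toℕ-fromℕ< _)) (rankℕ-< u<v)

  rank-reflects-< : ∀ {u v} → toℕ (rank u) < toℕ (rank v) → pos u < pos v
  rank-reflects-< {u} {v} ru<rv with <-cmp (pos u) (pos v)
  ... | tri< u<v _ _ = u<v
  ... | tri≈ _ u≡v _ = ⊥-elim (<-irrefl (cong (toℕ ∘ rank) (pos-inj u≡v)) ru<rv)
  ... | tri> _ _ v<u = ⊥-elim (<-asym ru<rv (rank-< v<u))

  rank-injective : Injective _≡_ _≡_ rank
  rank-injective {u} {v} ru≡rv with <-cmp (pos u) (pos v)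
  ... | tri< u<v _ _ = ⊥-elim (<-irrefl (cong toℕ ru≡rv) (rank-< u<v))
  ... | tri≈ _ u≡v _ = pos-inj u≡v
  ... | tri> _ _ v<u = ⊥-elim (<-irrefl (cong toℕ (sym ru≡rv)) (rank-< v<u))

  rankPermutation : Permutation n n
  rankPermutation = injective⇒permutation rank rank-injective

  unrank : Fin n → Fin n
  unrank = rankPermutation ⟨$⟩ˡ_

  unrank-< : ∀ {i j} → toℕ i < toℕ j → pos (unrank i) < pos (unrank j)
  unrank-< {i} {j} i<j = rank-reflects-<
    (subst₂ _<_ (sym (cong toℕ (Perm.inverseʳ rankPermutation))) (sym (cong toℕ (Perm.inverseʳ rankPermutation))) i<j)

  ΣF-unrank : ∀ (f : Fin n → ℕ) → ΣF n f ≡ ΣF n (f ∘ unrank)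
  ΣF-unrank f = ΣF-permute n f (Perm.flip rankPermutation)

  ΣF⁴-unrank : ∀ (F : Fin n → Fin n → Fin n → Fin n → ℕ) →
               ΣF² n (λ a b → ΣF² n (F a b)) ≡ ΣF² n (λ i j → ΣF² n (λ l m → F (unrank i) (unrank j) (unrank l) (unrank m)))
  ΣF⁴-unrank F = trans (ΣF-unrank _) (ΣF-cong n λ i → trans (ΣF-unrank _) (ΣF-cong n λ j →
                   trans (ΣF-unrank _) (ΣF-cong n λ l → ΣF-unrank _)))

-- From a drawing to an assignment

module _ {k n} (D : KPageDrawing k n) where
  open KPageDrawing D
  open Spine D
  open Rank pos pos-inj

  assignmentOf : Assignment k n
  assignmentOf i j p = edgePage (unrank i) (unrank j) ≡F p

  unsatWeight-assignmentOf : unsatWeight k n assignmentOf ≤ crossings D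
  unsatWeight-assignmentOf = begin
    unsatWeight k n x
      ≡⟨ unsatWeight-split k n x ⟩
    conflicts k n x + uncovered k n x * (k * edgeCount n)
      ≡⟨ cong (λ c → conflicts k n x + c * (k * edgeCount n)) (ΣF²-zero n none-uncovered) ⟩
    conflicts k n x + 0
      ≡⟨ +-identityʳ _ ⟩
    conflicts k n x
      ≤⟨ ΣF⁴-mono-≤ n (λ i j l m → ΣF-shared-page k (overlapB n i j l m) (e i j) (e l m)) ⟩
    ΣF² n (λ i j → ΣF² n λ l m → [ overlapB n i j l m ∧ (e i j ≡F e l m) ])
      ≤⟨ ΣF⁴-mono-≤ n (λ i j l m → []-mono (overlap⇒chain i j l m)) ⟩
    ΣF² n (λ i j → ΣF² n λ l m → [ crossingChain (unrank i) (unrank j) (unrank l) (unrank m) ])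
      ≡⟨ ΣF⁴-unrank (λ a b c d → [ crossingChain a b c d ]) ⟨
    spineCrossings
      ≡⟨ crossings≡spineCrossings ⟨
    crossings D
      ∎
    where
    open ≤-Reasoning
    x : Assignment k n
    x = assignmentOf

    e : Fin n → Fin n → Fin k
    e i j = edgePage (unrank i) (unrank j)

    none-uncovered : ∀ i j → [ isChord n i j ∧ not (any (x i j) (allFin k)) ] ≡ 0
    none-uncovered i j = []-false λ t →
      T-not⇒¬T (proj₂ (split-∧ᵀ (isChord n i j) t)) (any⁺ (x i j) (lose (∈-allFin (e i j)) (≡⇒≡F {a = e i j} refl)))

    overlap⇒chain : ∀ i j l m → T (overlapB n i j l m ∧ (e i j ≡F e l m)) →
                    T (crossingChain (unrank i) (unrank j) (unrank l) (unrank m))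
    overlap⇒chain i j l m t =
      let ov , same = split-∧ᵀ (overlapB n i j l m) t
          i<l , l<j , j<m = overlapB-ordered i j l m ov
      in same ∧ᵀ <⇒<ᵇ (unrank-< i<l) ∧ᵀ <⇒<ᵇ (unrank-< l<j) ∧ᵀ <⇒<ᵇ (unrank-< j<m)

-- From an assignment to a drawing

pickTrue : ∀ {k} → (Fin (suc k) → Bool) → Fin (suc k)
pickTrue f with any? (λ p → T? (f p))
... | yes (p , _) = p
... | no _ = zero

pickTrue-true : ∀ {k} (f : Fin (suc k) → Bool) → T (any f (allFin (suc k))) → T (f (pickTrue f))
pickTrue-true f t with any? (λ p → T? (f p))
... | yes (_ , fp) = fp
... | no none = ⊥-elim (none (satisfied (any⁻ f (allFin _) t)))

drawingOf : ∀ {k n} → Assignment (suc k) n → KPageDrawing (suc k) n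
drawingOf x = record { pos = toℕ ; pos-inj = toℕ-injective ; page = λ u v → pickTrue (x u v) }

module _ {k n} (x : Assignment (suc k) n) where
  open Spine (drawingOf x)

  chain⇒overlap : ∀ a b c d → T (crossingChain a b c d) → T (overlapB n a b c d)
  chain⇒overlap a b c d t = let _ , a<c , c<b , b<d = crossingChain⇒ a b c d t in ordered⇒overlapB a b c d a<c c<b b<d

  crossings-drawingOf : crossings (drawingOf x) ≤ unsatWeight (suc k) n x
  crossings-drawingOf with any? (λ i → any? (λ j → T? (isChord n i j ∧ not (any (x i j) (allFin (suc k))))))
  ... | yes (i , j , uncov) = begin
    crossings (drawingOf x)         ≡⟨ crossings≡spineCrossings ⟩
    spineCrossings                  ≤⟨ ΣF⁴-mono-≤ n (λ a b c d → []-mono (chain⇒overlap a b c d)) ⟩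
    edgeCount n                     ≤⟨ m≤n*m (edgeCount n) (suc k) ⟩
    K                               ≡⟨ *-identityˡ K ⟨
    1 * K                           ≤⟨ *-monoˡ-≤ K (≤-trans (≤-reflexive (sym ([]-true uncov))) (≤-ΣF² n _ i j)) ⟩
    uncovered (suc k) n x * K       ≤⟨ m≤n+m _ (conflicts (suc k) n x) ⟩
    conflicts (suc k) n x + uncovered (suc k) n x * K  ≡⟨ unsatWeight-split (suc k) n x ⟨
    unsatWeight (suc k) n x         ∎
    where
    open ≤-Reasoning
    K : ℕ
    K = suc k * edgeCount n
  ... | no all-covered = begin
    crossings (drawingOf x)   ≡⟨ crossings≡spineCrossings ⟩
    spineCrossings            ≤⟨ ΣF⁴-mono-≤ n chain⇒conflict ⟩
    conflicts (suc k) n x     ≤⟨ m≤m+n _ _ ⟩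
    conflicts (suc k) n x + uncovered (suc k) n x * (suc k * edgeCount n)  ≡⟨ unsatWeight-split (suc k) n x ⟨
    unsatWeight (suc k) n x   ∎
    where
    open ≤-Reasoning
    covered : ∀ i j → T (isChord n i j) → T (x i j (pickTrue (x i j)))
    covered i j chord with T? (any (x i j) (allFin (suc k)))
    ... | yes t = pickTrue-true (x i j) t
    ... | no ¬t = ⊥-elim (all-covered (i , j , chord ∧ᵀ ¬T⇒T-not ¬t))

    chain⇒conflict : ∀ a b c d → [ crossingChain a b c d ] ≤ ΣF (suc k) (λ p → [ overlapB n a b c d ∧ x a b p ∧ x c d p ])
    chain⇒conflict a b c d = []≤ λ t →
      let ov = chain⇒overlap a b c d t
          chord-ab , t′ = split-∧ᵀ (isChord n a b) ov
          chord-cd , _ = split-∧ᵀ (isChord n c d) t′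
          same , _ = crossingChain⇒ a b c d t
          a<b , c<d = crossingChain-ordered a b c d t
          p≡p′ : pickTrue (x a b) ≡ pickTrue (x c d)
          p≡p′ = trans (sym (edgePage-< {a} {b} (<⇒<ᵇ a<b))) (trans (≡F⇒≡ _ _ same) (edgePage-< {c} {d} (<⇒<ᵇ c<d)))
          xcd = subst (T ∘ x c d) (sym p≡p′) (covered c d chord-cd)
      in ≤-trans (≤-reflexive (sym ([]-true (ov ∧ᵀ covered a b chord-ab ∧ᵀ xcd)))) (≤-ΣF (suc k) _ (pickTrue (x a b)))

lemma3 : (n k : ℕ) → 3 ≤ n → 1 ≤ k →
    Σ ℕ (λ m → IsPageCrossingNumberK k n m × IsMinUnsatWeight k n m)
lemma3 n (suc k) _ _ with x₀ , x₀-minimal ← assignment-hasMinima (suc k) n (unsatWeight (suc k) n) (unsatWeight-cong (suc k) n)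
  = unsatWeight (suc k) n x₀ , ((drawingOf x₀ , drawingOf-optimal) , lower-bound) , (x₀ , refl) , x₀-minimal
  where
  lower-bound : ∀ D → unsatWeight (suc k) n x₀ ≤ crossings D
  lower-bound D = ≤-trans (x₀-minimal (assignmentOf D)) (unsatWeight-assignmentOf D)

  drawingOf-optimal : crossings (drawingOf x₀) ≡ unsatWeight (suc k) n x₀
  drawingOf-optimal = ≤-antisym (crossings-drawingOf x₀) (lower-bound (drawingOf x₀))
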